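{- Let $\Psi=\Pi:\varphi$ be a DQBF, let $v$ be a variable, and let $V'=\mathrm{dep}(v)$. Let $U^1$ be such that $\mathrm{abs}(\Pi:\varphi\land v,V')\vdash_{1\forall}U^1$ if no conflict occurs there, and $U^1=\emptyset$ otherwise. Let $U^0$ be such that $\mathrm{abs}(\Pi:\varphi\land\neg v,V')\vdash_{1\forall}U^0$ if no conflict occurs there, and $U^0=\emptyset$ otherwise. Then: (1) If $\mathrm{abs}(\Pi:\varphi\land v,V')\vdash_{1\forall}\bot$, then $\Psi\equiv\Pi:\varphi\land\neg v$. If $\mathrm{abs}(\Pi:\varphi\land\neg v,V')\vdash_{1\forall}\bot$, then $\Psi\equiv\Pi:\varphi\land v$. (2) $\Psi\equiv\Pi:\varphi\land\bigwedge_{\kappa\in U^0\cap U^1}\kappa$. (3) $\Psi\equiv\Pi:\varphi\land\bigwedge_{\kappa:\ \kappa\in U^1,\ \neg\kappa\in U^0}(v\equiv\kappa)$.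
   Context: A DQBF over a finite set $V=\{x_1,\dots,x_n,y_1,\dots,y_m\}$ of Boolean variables has the form $\forall x_1\ldots\forall x_n\exists y_1(D_{y_1})\ldots\exists y_m(D_{y_m}):\varphi$, where $D_{y_i}\subseteq\{x_1,\dots,x_n\}$ is the dependency set of $y_i$ and the matrix $\varphi$ is a CNF over $V$, treated as a set of clauses, each clause a set of literals. The prefix is treated as a set $\Pi$ and the DQBF is written $\Pi:\varphi$. $V_\exists$ and $V_\forall$ denote the existential and universal variables. For a set $X$ of variables, $\mathcal{A}(X)$ is the set of assignments $X\to\{0,1\}$. A Skolem function for a DQBF is a family $(s_y)_{y\in V_\exists}$ with $s_y:\mathcal{A}(D_y)\to\{0,1\}$ such that replacing every $y$ by $s_y$ turns the matrix into a tautology. Two DQBFs over the same existential and universal variables are equivalent ($\equiv$) iff they have exactly the same Skolem functions. Dependencies are defined by $\mathrm{dep}(v)=\{v\}$ if $v$ is universal and $\mathrm{dep}(v)=D_v$ if $v$ is existential. For a literal $\ell$, $\Pi:\varphi\land\ell$ denotes $\varphi$ with the unit clause $\{\ell\}$ added. Adding a formula such as $(v\equiv\kappa)$ means adding its CNF clauses $(\neg v\lor\kappa)$ and $(v\lor\neg\kappa)$. Abstraction: for $V'\subseteq V_\forall$, $\mathrm{abs}(\Pi:\varphi,V')$ is the DQBF with the same matrix in which each $w\in V'$ is removed as a universal variable, removed from all dependency sets, and instead quantified as $\exists w(\emptyset)$. Universal reduction: for a non-tautological clause $C$, $\mathrm{UR}(C)$ removes from $C$ every universal literal $\ell$ for which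 no existential literal $k\in C$ has $\mathrm{var}(\ell)\in D_{\mathrm{var}(k)}$. Also $\mathrm{UR}(\Pi:\varphi)=\Pi:\{\mathrm{UR}(C)\mid C\in\varphi\}$. Unit propagation: let $U$ be the set of literals $\ell$ with $\{\ell\}\in\varphi$ and $\mathrm{var}(\ell)$ existential. Define $\mathrm{UP}^1(\Pi:\varphi)=\mathrm{UR}\bigl(\Pi\setminus\{\mathrm{var}(\ell)\mid\ell\in U\}:\{C\setminus\{\neg\ell\mid\ell\in U\}\mid C\in\varphi,\ C\cap U=\emptyset\}\bigr)$. Iterate to a fixpoint $\mathrm{UP}(\Pi:\varphi)$. Write $\Pi:\varphi\vdash_{1\forall}\bot$ if the empty clause is in $\mathrm{UP}(\Pi:\varphi)$. Otherwise write $\Pi:\varphi\vdash_{1\forall}U$, where $U$ is the set of all unit literals processed in all rounds. -}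

module Defs where

open import Data.Bool using (Bool; true; false; not; _∧_; _∨_; if_then_else_)
open import Data.Nat using (ℕ; zero; suc; _+_; _≡ᵇ_)
open import Data.List using (List; []; _∷_; _++_; map; filterᵇ; length; concatMap; null)
open import Data.Bool.ListAction using (any; all)
open import Data.List.Membership.Propositional using (_∈_)
open import Data.List.Relation.Unary.All using (All)
open import Data.List.Relation.Unary.Unique.Propositional using (Unique)
open import Data.Product using (_×_; _,_; proj₁; proj₂)
open import Data.Empty using (⊥)
open import Relation.Binary.PropositionalEquality using (_≡_)
open import Function.Bundles using (_⇔_)

Var : Set
Var = ℕ

data Lit : Set where
  pos : Var → Lit
  neg : Var → Lit

var : Lit → Var
var (pos x) = x
var (neg x) = x

negL : Lit → Lit
negL (pos x) = neg x
negL (neg x) = pos x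

_==L_ : Lit → Lit → Bool
pos x ==L pos y = x ≡ᵇ y
neg x ==L neg y = x ≡ᵇ y
_     ==L _     = false

memℕ : ℕ → List ℕ → Bool
memℕ x xs = any (x ≡ᵇ_) xs

memL : Lit → List Lit → Bool
memL ℓ xs = any (ℓ ==L_) xs

-- Clauses are (lists representing) sets of literals; a CNF is a list of clauses
-- (representing a set of clauses).
Clause : Set
Clause = List Lit

CNF : Set
CNF = List Clause

-- A prefix Π: the universal variables, and the existential variables y each
-- with its dependency set D_y.
record Prefix : Set where
  constructor mkPrefix
  field
    univs : List Var
    exs   : List (Var × List Var)
open Prefix public

exVars : Prefix → List Var
exVars Π = map proj₁ (exs Π)

allVars : Prefix → List Var
allVars Π = univs Π ++ exVars Π

isUniv : Prefix → Var → Bool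
isUniv Π x = memℕ x (univs Π)

isExist : Prefix → Var → Bool
isExist Π x = memℕ x (exVars Π)

depsOf : Prefix → Var → List Var
depsOf Π y = go (exs Π)
  where
  go : List (Var × List Var) → List Var
  go [] = []
  go ((z , D) ∷ r) = if y ≡ᵇ z then D else go r

dep : Prefix → Var → List Var
dep Π v = if isUniv Π v then v ∷ [] else depsOf Π v

WellFormed : Prefix → CNF → Set
WellFormed Π φ =
  Unique (allVars Π) ×
  All (λ p → All (λ x → x ∈ univs Π) (proj₂ p)) (exs Π) ×
  All (λ C → All (λ ℓ → var ℓ ∈ allVars Π) C) φ

-- A universal assignment (only values on V_∀ matter).
Assignment : Set
Assignment = Var → Bool

evalLit : Assignment → Lit → Bool
evalLit σ (pos x) = σ x
evalLit σ (neg x) = not (σ x)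

evalClause : Assignment → Clause → Bool
evalClause σ C = any (evalLit σ) C

evalCNF : Assignment → CNF → Bool
evalCNF σ φ = all (evalClause σ) φ

-- A candidate family (s_y)_y: s y α is the value of s_y on the universal
-- assignment α; it must depend only on α restricted to D_y, so that it is
-- exactly a function A(D_y) → {0,1}.
SkolemFamily : Set
SkolemFamily = Var → Assignment → Bool

RespectsDeps : Prefix → SkolemFamily → Set
RespectsDeps Π s = ∀ y D → (y , D) ∈ exs Π → ∀ (α β : Assignment) →
  (∀ x → x ∈ D → α x ≡ β x) → s y α ≡ s y β

extend : Prefix → SkolemFamily → Assignment → Assignment
extend Π s α z = if isExist Π z then s z α else α z

IsSkolem : Prefix → CNF → SkolemFamily → Set
IsSkolem Π φ s = RespectsDeps Π s × (∀ α → evalCNF (extend Π s α) φ ≡ true)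

Equiv : Prefix → CNF → CNF → Set
Equiv Π φ φ' = ∀ (s : SkolemFamily) → RespectsDeps Π s →
  (IsSkolem Π φ s ⇔ IsSkolem Π φ' s)

addUnit : CNF → Lit → CNF
addUnit φ ℓ = φ ++ ((ℓ ∷ []) ∷ [])

absPrefix : Prefix → List Var → Prefix
absPrefix Π V' = mkPrefix
  (filterᵇ (λ x → not (memℕ x V')) (univs Π))
  (map (λ p → (proj₁ p , filterᵇ (λ x → not (memℕ x V')) (proj₂ p))) (exs Π)
   ++ map (λ w → (w , [])) (filterᵇ (λ x → memℕ x V') (univs Π)))

tautological : Clause → Bool
tautological C = any (λ ℓ → memL (negL ℓ) C) C

URclause : Prefix → Clause → Clause
URclause Π C =
  if tautological C then C
  else filterᵇ keep C
  where
  keep : Lit → Bool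
  keep ℓ = not (isUniv Π (var ℓ))
         ∨ any (λ k → isExist Π (var k) ∧ memℕ (var ℓ) (depsOf Π (var k))) C

UR : Prefix → CNF → CNF
UR Π φ = map (URclause Π) φ

-- C = {ℓ} as a set: C is non-empty and all its elements are ℓ
isUnitClauseOf : Lit → Clause → Bool
isUnitClauseOf ℓ C = not (null C) ∧ all (ℓ ==L_) C

unitLitOf : Clause → List Lit
unitLitOf [] = []
unitLitOf (ℓ ∷ C) = if isUnitClauseOf ℓ (ℓ ∷ C) then ℓ ∷ [] else []

unitsOf : Prefix → CNF → List Lit
unitsOf Π φ = filterᵇ (λ ℓ → isExist Π (var ℓ)) (concatMap unitLitOf φ)

UP1 : Prefix → CNF → Prefix × CNF × List Lit
UP1 Π φ = (Π' , UR Π' φ' , U)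
  where
  U : List Lit
  U = unitsOf Π φ
  Uvars : List Var
  Uvars = map var U
  Π' : Prefix
  Π' = mkPrefix (filterᵇ (λ x → not (memℕ x Uvars)) (univs Π))
                (filterᵇ (λ p → not (memℕ (proj₁ p) Uvars)) (exs Π))
  φ' : CNF
  φ' = map (filterᵇ (λ ℓ → not (memL (negL ℓ) U)))
           (filterᵇ (λ C → not (any (λ ℓ → memL ℓ U) C)) φ)

UPiter : ℕ → Prefix → CNF → Prefix × CNF × List Lit
UPiter zero    Π φ = (Π , φ , [])
UPiter (suc n) Π φ with UP1 Π φ
... | (Π' , φ' , U) with UPiter n Π' φ'
...   | (Π'' , φ'' , U') = (Π'' , φ'' , U ++ U')

-- The fixpoint is reached after at most |V_∃| + 2 rounds (each round that is
-- not a fixpoint, except possibly the first, removes an existential variable);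
-- further rounds change nothing, so this many rounds compute UP exactly.
UPbound : Prefix → ℕ
UPbound Π = length (univs Π) + length (exs Π) + 2

data UPResult : Set where
  conflict : UPResult
  units    : List Lit → UPResult

UP : Prefix → CNF → UPResult
UP Π φ with UPiter (UPbound Π) Π φ
... | (_ , φ' , U) = if any null φ' then conflict else units U

unitsOrEmpty : UPResult → List Lit
unitsOrEmpty conflict  = []
unitsOrEmpty (units U) = U

unitClauses : List Lit → CNF
unitClauses K = map (λ κ → κ ∷ []) K

equivClauses : Var → List Lit → CNF
equivClauses v K = concatMap (λ κ → (neg v ∷ κ ∷ []) ∷ (pos v ∷ negL κ ∷ []) ∷ []) K

U1 : Prefix → CNF → Var → List Lit
U1 Π φ v = unitsOrEmpty (UP (absPrefix Π (dep Π v)) (addUnit φ (pos v)))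

U0 : Prefix → CNF → Var → List Lit
U0 Π φ v = unitsOrEmpty (UP (absPrefix Π (dep Π v)) (addUnit φ (neg v)))

commonUnits : List Lit → List Lit → List Lit
commonUnits A B = filterᵇ (λ κ → memL κ A) B

oppositeUnits : List Lit → List Lit → List Lit
oppositeUnits A B = filterᵇ (λ κ → memL (negL κ) A) B

-- Fix a Skolem function s of Ψ and a universal assignment α, and let ℓ ∈ {v, ¬v} be the
-- literal that s makes true at α. Freezing the variables of V' = dep(v) to their α-values
-- turns s into a Skolem function of abs(Π:φ ∧ ℓ, V'): the frozen variables become constant
-- existentials, and since s_v only reads V', ℓ holds under every remaining universal
-- assignment. Universal reduction and unit propagation only derive literals that are true
-- under every Skolem function of the formula they act on, so this propagation ends without
-- a conflict and every derived literal is true at α. Thus a conflict for ℓ forces ¬ℓ, a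
-- literal in U⁰ ∩ U¹ holds whatever value v takes, and κ ∈ U¹ with ¬κ ∈ U⁰ agrees with v.

module Submission where

open import Defs
open import Data.Nat using (ℕ)
open import Data.List using (_++_)
open import Data.List.Membership.Propositional using (_∈_)
open import Data.Product using (_×_)
open import Relation.Binary.PropositionalEquality using (_≡_)

open import Data.Bool using (Bool; true; false; not; _∧_; _∨_; if_then_else_; T)
open import Data.Bool.ListAction using (any; all)
open import Data.Bool.Properties using (T-∧; T-≡; T-not-≡; not-involutive)
open import Data.Nat using (zero; suc; _≡ᵇ_)
open import Data.Nat.Properties using (≡ᵇ⇒≡; ≡⇒≡ᵇ)
open import Data.List using (List; []; _∷_; map; filterᵇ; null)
open import Data.List.Properties using (map-++; map-∘; map-id)
open import Data.List.Membership.Propositional using (find; lose)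
open import Data.List.Membership.Propositional.Properties
  using (∈-map⁺; ∈-map⁻; ∈-++⁺ˡ; ∈-++⁺ʳ; ∈-++⁻; ∈-filter⁺; ∈-filter⁻; ∈-concatMap⁻)
open import Data.List.Relation.Binary.Subset.Propositional using (_⊆_)
open import Data.List.Relation.Binary.Subset.Propositional.Properties using (filter-⊆)
open import Data.List.Relation.Unary.Any as Any using (Any; here; there)
open import Data.List.Relation.Unary.Any.Properties using (any⁺; any⁻)
open import Data.List.Relation.Unary.All as All using (All; []; _∷_)
open import Data.List.Relation.Unary.All.Properties
  using (all⁺; all⁻; anti-mono; map⁺; concat⁺; ++⁺; ++⁻ˡ)
open import Data.List.Relation.Unary.AllPairs using (_∷_)
open import Data.List.Relation.Unary.Unique.Propositional using (Unique)
open import Data.Product using (_,_; proj₁; proj₂; ∃)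
open import Data.Sum using (_⊎_; inj₁; inj₂)
open import Data.Empty using (⊥)
open import Function using (_∘_; id; Equivalence; _⇔_; mk⇔)
open Equivalence using (to; from)
open import Relation.Nullary using (¬_; contradiction; yes; no)
open import Relation.Nullary.Decidable using (T?)
open import Relation.Binary.PropositionalEquality
  using (_≗_; refl; sym; trans; cong; cong₂; subst; module ≡-Reasoning)

private
  variable
    A : Set

¬T⇒≡false : ∀ {b} → ¬ T b → b ≡ false
¬T⇒≡false {false} _ = refl
¬T⇒≡false {true}  h = contradiction _ h

≡false⇒¬T : ∀ {b} → b ≡ false → ¬ T b
≡false⇒¬T refl ()

T-not⇒¬T : ∀ {b} → T (not b) → ¬ T b
T-not⇒¬T {false} _ ()

¬T⇒T-not : ∀ {b} → ¬ T b → T (not b)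
¬T⇒T-not {false} _ = _
¬T⇒T-not {true}  h = h _

T-ext : ∀ {a b} → (T a → T b) → (T b → T a) → a ≡ b
T-ext {false} {false} _ _ = refl
T-ext {false} {true}  _ g = contradiction (g _) id
T-ext {true}  {false} f _ = contradiction (f _) id
T-ext {true}  {true}  _ _ = refl

∈-filterᵇ⁺ : ∀ (p : A → Bool) {x xs} → x ∈ xs → T (p x) → x ∈ filterᵇ p xs
∈-filterᵇ⁺ p = ∈-filter⁺ (T? ∘ p)

∈-filterᵇ⁻ : ∀ (p : A → Bool) {x xs} → x ∈ filterᵇ p xs → x ∈ xs × T (p x)
∈-filterᵇ⁻ p = ∈-filter⁻ (T? ∘ p)

Unique-++⇒disjoint : ∀ {xs ys : List A} {x} → Unique (xs ++ ys) → x ∈ xs → x ∈ ys → ⊥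
Unique-++⇒disjoint {xs = _ ∷ xs} (x∉ ∷ _) (here refl) x∈ys = All.lookup x∉ (∈-++⁺ʳ xs x∈ys) refl
Unique-++⇒disjoint {xs = _ ∷ _} (_ ∷ u) (there x∈xs) x∈ys = Unique-++⇒disjoint u x∈xs x∈ys

module BooleanMembership {_==_ : A → A → Bool}
  (==⇒≡ : ∀ {a b} → T (a == b) → a ≡ b) (==-refl : ∀ a → T (a == a)) where

  any-==⁺ : ∀ {x xs} → x ∈ xs → T (any (x ==_) xs)
  any-==⁺ {x} x∈ = any⁺ _ (Any.map (λ { refl → ==-refl x }) x∈)

  any-==⁻ : ∀ x xs → T (any (x ==_) xs) → x ∈ xs
  any-==⁻ x xs h = Any.map ==⇒≡ (any⁻ _ xs h)

module ℕMembership = BooleanMembership {_==_ = _≡ᵇ_} (≡ᵇ⇒≡ _ _) (λ n → ≡⇒≡ᵇ n n refl)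

memℕ⁺ : ∀ {x xs} → x ∈ xs → T (memℕ x xs)
memℕ⁺ = ℕMembership.any-==⁺

memℕ⁻ : ∀ x xs → T (memℕ x xs) → x ∈ xs
memℕ⁻ = ℕMembership.any-==⁻

==L⇒≡ : ∀ a b → T (a ==L b) → a ≡ b
==L⇒≡ (pos x) (pos y) h = cong pos (≡ᵇ⇒≡ x y h)
==L⇒≡ (neg x) (neg y) h = cong neg (≡ᵇ⇒≡ x y h)

==L-refl : ∀ a → T (a ==L a)
==L-refl (pos x) = ≡⇒≡ᵇ x x refl
==L-refl (neg x) = ≡⇒≡ᵇ x x refl

module LitMembership = BooleanMembership (==L⇒≡ _ _) ==L-refl

memL⁺ : ∀ {ℓ C} → ℓ ∈ C → T (memL ℓ C)
memL⁺ = LitMembership.any-==⁺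

memL⁻ : ∀ ℓ C → T (memL ℓ C) → ℓ ∈ C
memL⁻ = LitMembership.any-==⁻

same-var : ∀ ℓ k → var k ≡ var ℓ → k ≡ ℓ ⊎ k ≡ negL ℓ
same-var (pos x) (pos .x) refl = inj₁ refl
same-var (pos x) (neg .x) refl = inj₂ refl
same-var (neg x) (pos .x) refl = inj₂ refl
same-var (neg x) (neg .x) refl = inj₁ refl

Holds : Assignment → Lit → Set
Holds σ ℓ = T (evalLit σ ℓ)

Sat : Assignment → Clause → Set
Sat σ C = Any (Holds σ) C

evalCNF⇔All : ∀ {σ} φ → T (evalCNF σ φ) ⇔ All (Sat σ) φ
evalCNF⇔All φ = mk⇔ (All.map (any⁻ _ _) ∘ all⁺ _ φ) (all⁻ _ ∘ All.map (any⁺ _))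

evalLit-cong : ∀ {σ τ} ℓ → σ (var ℓ) ≡ τ (var ℓ) → evalLit σ ℓ ≡ evalLit τ ℓ
evalLit-cong (pos x) eq = eq
evalLit-cong (neg x) eq = cong not eq

Holds-cong : ∀ {σ τ} ℓ → σ (var ℓ) ≡ τ (var ℓ) → Holds σ ℓ → Holds τ ℓ
Holds-cong ℓ eq = subst T (evalLit-cong ℓ eq)

evalLit-negL : ∀ {σ} ℓ → evalLit σ (negL ℓ) ≡ not (evalLit σ ℓ)
evalLit-negL (pos x) = refl
evalLit-negL {σ} (neg x) = sym (not-involutive (σ x))

Holds-negL⁻ : ∀ {σ} ℓ → Holds σ (negL ℓ) → ¬ Holds σ ℓ
Holds-negL⁻ ℓ = T-not⇒¬T ∘ subst T (evalLit-negL ℓ)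

Holds-negL⁺ : ∀ {σ} ℓ → ¬ Holds σ ℓ → Holds σ (negL ℓ)
Holds-negL⁺ ℓ = subst T (sym (evalLit-negL ℓ)) ∘ ¬T⇒T-not

Sat-cong : ∀ {σ τ} → σ ≗ τ → ∀ {C} → Sat σ C → Sat τ C
Sat-cong σ≗τ = Any.map λ {ℓ} → Holds-cong ℓ (σ≗τ (var ℓ))

Holds-pos⊎neg : ∀ σ x → Holds σ (pos x) ⊎ Holds σ (neg x)
Holds-pos⊎neg σ x with σ x
... | true  = inj₁ _
... | false = inj₂ _

IsSkolem⇔ : ∀ Π φ {s} → IsSkolem Π φ s ⇔ (RespectsDeps Π s × ∀ α → All (Sat (extend Π s α)) φ)
IsSkolem⇔ Π φ = mk⇔ (λ (r , k) → r , λ α → to (evalCNF⇔All φ) (from T-≡ (k α)))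
                    (λ (r , k) → r , λ α → to T-≡ (from (evalCNF⇔All φ) (k α)))

Equiv-++ : ∀ Π φ {ψ} → (∀ {s} → IsSkolem Π φ s → ∀ α → All (Sat (extend Π s α)) ψ) →
           Equiv Π φ (φ ++ ψ)
Equiv-++ Π φ {ψ} implied s _ = mk⇔
  (λ skolem → let r , k = to (IsSkolem⇔ Π φ) skolem
              in from (IsSkolem⇔ Π (φ ++ ψ)) (r , λ α → ++⁺ (k α) (implied skolem α)))
  (λ skolem → let r , k = to (IsSkolem⇔ Π (φ ++ ψ)) skolem
              in from (IsSkolem⇔ Π φ) (r , λ α → ++⁻ˡ φ (k α)))

depsOf-∈ : ∀ Π {y} → T (isExist Π y) → (y , depsOf Π y) ∈ exs Π
depsOf-∈ (mkPrefix u es) = go es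
  where
  go : ∀ es {y} → T (memℕ y (map proj₁ es)) → (y , depsOf (mkPrefix u es) y) ∈ es
  go ((z , D) ∷ es) {y} h with y ≡ᵇ z in eq
  ... | true rewrite ≡ᵇ⇒≡ y z (from T-≡ eq) = here refl
  ... | false = there (go es h)

extend-¬exist : ∀ Π s α {z} → isExist Π z ≡ false → extend Π s α z ≡ α z
extend-¬exist Π s α {z} = cong (λ b → if b then s z α else α z)

extend-exist : ∀ Π s α {z} → isExist Π z ≡ true → extend Π s α z ≡ s z α
extend-exist Π s α {z} = cong (λ b → if b then s z α else α z)

extend-cong : ∀ Π {s α β} → RespectsDeps Π s → α ≗ β → extend Π s α ≗ extend Π s β
extend-cong Π s-resp α≗β z with isExist Π z in e
... | true  = s-resp z _ (depsOf-∈ Π (from T-≡ e)) _ _ (λ x _ → α≗β x)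
... | false = α≗β z

module _ (Π : Prefix) (univ⇒¬exist : ∀ {x} → x ∈ univs Π → isExist Π x ≡ false) where

  ¬univ⇒exist : ∀ {v} → v ∈ allVars Π → isUniv Π v ≡ false → T (isExist Π v)
  ¬univ⇒exist {v} v∈ ¬univ with ∈-++⁻ (univs Π) v∈
  ... | inj₁ v∈univs = contradiction (memℕ⁺ v∈univs) (≡false⇒¬T ¬univ)
  ... | inj₂ v∈exVars = memℕ⁺ v∈exVars

  extend-dep : ∀ {s α β v} → RespectsDeps Π s → v ∈ allVars Π →
               (∀ x → x ∈ dep Π v → α x ≡ β x) → extend Π s α v ≡ extend Π s β v
  extend-dep {s} {α} {β} {v} s-resp v∈ agree with isUniv Π v in univ
  ... | true  = begin
    extend Π s α v ≡⟨ extend-¬exist Π s α v∄ ⟩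
    α v            ≡⟨ agree v (here refl) ⟩
    β v            ≡⟨ extend-¬exist Π s β v∄ ⟨
    extend Π s β v ∎
    where
    open ≡-Reasoning
    v∄ : isExist Π v ≡ false
    v∄ = univ⇒¬exist (memℕ⁻ v _ (from T-≡ univ))
  ... | false = begin
    extend Π s α v ≡⟨ extend-exist Π s α (to T-≡ v∃) ⟩
    s v α          ≡⟨ s-resp v _ (depsOf-∈ Π v∃) α β agree ⟩
    s v β          ≡⟨ extend-exist Π s β (to T-≡ v∃) ⟨
    extend Π s β v ∎
    where
    open ≡-Reasoning
    v∃ : T (isExist Π v)
    v∃ = ¬univ⇒exist v∈ univ

unitLitOf-holds : ∀ {σ ℓ} C → ℓ ∈ unitLitOf C → Sat σ C → Holds σ ℓ
unitLitOf-holds (a ∷ C) ℓ∈ sat with all (a ==L_) (a ∷ C) in unit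
unitLitOf-holds {σ} (a ∷ C) (here refl) sat | true with find sat
... | k , k∈ , h =
  subst (Holds σ) (sym (==L⇒≡ a k (All.lookup (all⁺ _ (a ∷ C) (from T-≡ unit)) k∈))) h

no-empty-clause : ∀ {σ φ} → All (Sat σ) φ → any null φ ≡ false
no-empty-clause [] = refl
no-empty-clause (_∷_ {x = []} () _)
no-empty-clause (_∷_ {x = _ ∷ _} _ sats) = no-empty-clause sats

-- Soundness of universal reduction and unit propagation

dependedOn : Prefix → Clause → Var → Bool
dependedOn Π C x = any (λ k → isExist Π (var k) ∧ memℕ x (depsOf Π (var k))) C

module UnitPropagationSound (P : Prefix) (s : SkolemFamily) (s-resp : RespectsDeps P s)
  (univ⇒¬exist : ∀ {x} → x ∈ univs P → isExist P x ≡ false) where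

  γ : Assignment → Assignment
  γ = extend P s

  record SubPrefix (Π : Prefix) : Set where
    field
      univs-⊆ : univs Π ⊆ univs P
      exs-⊆   : exs Π ⊆ exs P

  -- Propagation shrinks the prefix while s stays a Skolem family of P; an existential of P
  -- still occurring in a clause must keep its quantifier, so that its dependency set is known.
  ExistsIn : Prefix → Clause → Set
  ExistsIn Π C = All (λ ℓ → T (isExist P (var ℓ)) → T (isExist Π (var ℓ))) C

  Valid : CNF → Set
  Valid φ = ∀ β → All (Sat (γ β)) φ

  module _ {Π} (sub : SubPrefix Π) {C} (C-exists : ExistsIn Π C) where
    open SubPrefix sub

    reducible : Var → Bool
    reducible x = isUniv Π x ∧ not (dependedOn Π C x)

    -- No Skolem value in C reads a reducible universal x, so setting x to make its literals
    -- in C false (C is no tautology) changes no other literal of C: some kept one is true.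
    falsify : Assignment → Assignment
    falsify β x = if reducible x then memL (neg x) C else β x

    falsify-id : ∀ β {x} → ¬ T (reducible x) → falsify β x ≡ β x
    falsify-id β ¬r rewrite ¬T⇒≡false ¬r = refl

    γ-falsify : ∀ β {x} → T (reducible x) → γ (falsify β) x ≡ memL (neg x) C
    γ-falsify β {x} r =
      trans (extend-¬exist P s (falsify β) (univ⇒¬exist (univs-⊆ (memℕ⁻ x _ (proj₁ (to T-∧ r))))))
            (cong (λ b → if b then memL (neg x) C else β x) (to T-≡ r))

    reducible-fails : tautological C ≡ false → ∀ β {ℓ} → ℓ ∈ C → T (reducible (var ℓ)) →
                      ¬ Holds (γ (falsify β)) ℓ
    reducible-fails taut β {pos x} pos∈C r h =
      ≡false⇒¬T taut (any⁺ _ (lose pos∈C (subst T (γ-falsify β r) h)))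
    reducible-fails taut β {neg x} neg∈C r h =
      T-not⇒¬T (subst (T ∘ not) (γ-falsify β r) h) (memL⁺ neg∈C)

    falsify-agrees : ∀ β {ℓ} → ℓ ∈ C → ¬ T (reducible (var ℓ)) → γ (falsify β) (var ℓ) ≡ γ β (var ℓ)
    falsify-agrees β {ℓ} ℓ∈C ¬r with isExist P (var ℓ) in e
    ... | false = falsify-id β ¬r
    ... | true  = s-resp (var ℓ) _ (exs-⊆ (depsOf-∈ Π ℓ∃)) (falsify β) β
                    (λ x x∈ → falsify-id β (dependedOn⇒¬reducible {x} (any⁺ _ (lose ℓ∈C
                                (from T-∧ (ℓ∃ , memℕ⁺ x∈))))))
      where
      ℓ∃ : T (isExist Π (var ℓ))
      ℓ∃ = All.lookup C-exists ℓ∈C (from T-≡ e)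
      dependedOn⇒¬reducible : ∀ {x} → T (dependedOn Π C x) → ¬ T (reducible x)
      dependedOn⇒¬reducible d r = T-not⇒¬T (proj₂ (to T-∧ r)) d

    ¬reducible⇒kept : ∀ x → ¬ T (isUniv Π x ∧ not (dependedOn Π C x)) →
                      T (not (isUniv Π x) ∨ dependedOn Π C x)
    ¬reducible⇒kept x ¬r with isUniv Π x | dependedOn Π C x
    ... | false | _     = _
    ... | true  | true  = _
    ... | true  | false = ¬r _

    URclause-valid : (∀ β → Sat (γ β) C) → ∀ β → Sat (γ β) (URclause Π C)
    URclause-valid valid β with tautological C in taut
    ... | true  = valid β
    ... | false with find (valid (falsify β))
    ...   | ℓ , ℓ∈C , holds with T? (reducible (var ℓ))
    ...     | yes r  = contradiction holds (reducible-fails taut β ℓ∈C r)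
    ...     | no ¬r  = lose (∈-filterᵇ⁺ _ ℓ∈C (¬reducible⇒kept (var ℓ) ¬r))
                            (Holds-cong ℓ (falsify-agrees β ℓ∈C ¬r) holds)

  URclause-⊆ : ∀ Π C → URclause Π C ⊆ C
  URclause-⊆ Π C with tautological C
  ... | true  = id
  ... | false = filter-⊆ _ C

  ClauseInvariant : Prefix → Clause → Set
  ClauseInvariant Π C = ExistsIn Π C × (∀ β → Sat (γ β) C)

  Invariant : Prefix → CNF → Set
  Invariant Π φ = SubPrefix Π × All (ClauseInvariant Π) φ

  UR-invariant : ∀ {Π φ} → Invariant Π φ → Invariant Π (UR Π φ)
  UR-invariant {Π} (sub , clauses) = sub , map⁺ (All.map reduce clauses)
    where
    reduce : ∀ {C} → ClauseInvariant Π C → ClauseInvariant Π (URclause Π C)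
    reduce {C} (C-exists , valid) =
      anti-mono (URclause-⊆ Π C) C-exists , URclause-valid sub C-exists valid

  module Round {Π φ} (inv : Invariant Π φ) where
    open SubPrefix (proj₁ inv)

    U : List Lit
    U = unitsOf Π φ

    units-hold : ∀ β → All (Holds (γ β)) U
    units-hold β = All.tabulate λ {ℓ} ℓ∈U →
      let C , C∈φ , ℓ∈C = find (∈-concatMap⁻ unitLitOf (proj₁ (∈-filterᵇ⁻ _ ℓ∈U)))
      in unitLitOf-holds C ℓ∈C (proj₂ (All.lookup (proj₂ inv) C∈φ) β)

    satisfiedByU : Clause → Bool
    satisfiedByU C = any (λ ℓ → memL ℓ U) C

    refutedByU : Lit → Bool
    refutedByU ℓ = memL (negL ℓ) U

    Π′ : Prefix
    Π′ = mkPrefix (filterᵇ (λ x → not (memℕ x (map var U))) (univs Π))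
                  (filterᵇ (λ p → not (memℕ (proj₁ p) (map var U))) (exs Π))

    Π′-sub : SubPrefix Π′
    Π′-sub = record
      { univs-⊆ = univs-⊆ ∘ proj₁ ∘ ∈-filterᵇ⁻ _
      ; exs-⊆   = λ p∈ → exs-⊆ (proj₁ (∈-filterᵇ⁻ _ p∈))
      }

    reduced-invariant : ∀ {C} → C ∈ φ → T (not (satisfiedByU C)) →
                        ClauseInvariant Π′ (filterᵇ (not ∘ refutedByU) C)
    reduced-invariant {C} C∈φ unsat = All.tabulate still-exists , still-valid
      where
      C-inv : ClauseInvariant Π C
      C-inv = All.lookup (proj₂ inv) C∈φ

      var∉U : ∀ {ℓ} → ℓ ∈ C → T (not (refutedByU ℓ)) → ¬ var ℓ ∈ map var U
      var∉U {ℓ} ℓ∈C unrefuted v∈ with ∈-map⁻ var v∈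
      ... | u , u∈U , eq with same-var ℓ u (sym eq)
      ...   | inj₁ refl = T-not⇒¬T unsat (any⁺ _ (lose ℓ∈C (memL⁺ u∈U)))
      ...   | inj₂ refl = T-not⇒¬T unrefuted (memL⁺ u∈U)

      still-exists : ∀ {ℓ} → ℓ ∈ filterᵇ (not ∘ refutedByU) C →
                     T (isExist P (var ℓ)) → T (isExist Π′ (var ℓ))
      still-exists {ℓ} ℓ∈ ℓ∃P =
        let ℓ∈C , unrefuted = ∈-filterᵇ⁻ _ ℓ∈
            ℓ∃ = All.lookup (proj₁ C-inv) ℓ∈C ℓ∃P
        in memℕ⁺ (∈-map⁺ proj₁ (∈-filterᵇ⁺ _ (depsOf-∈ Π {var ℓ} ℓ∃)
                                  (¬T⇒T-not (var∉U ℓ∈C unrefuted ∘ memℕ⁻ (var ℓ) _))))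

      still-valid : ∀ β → Sat (γ β) (filterᵇ (not ∘ refutedByU) C)
      still-valid β with find (proj₂ C-inv β)
      ... | ℓ , ℓ∈C , holds with T? (refutedByU ℓ)
      ...   | yes refuted = contradiction holds
                              (Holds-negL⁻ ℓ (All.lookup (units-hold β) (memL⁻ (negL ℓ) U refuted)))
      ...   | no ¬refuted = lose (∈-filterᵇ⁺ _ ℓ∈C (¬T⇒T-not ¬refuted)) holds

    φ′ : CNF
    φ′ = map (filterᵇ (not ∘ refutedByU)) (filterᵇ (not ∘ satisfiedByU) φ)

    φ′-invariant : Invariant Π′ φ′
    φ′-invariant = Π′-sub , map⁺ (All.tabulate λ C∈ →
      let C∈φ , unsat = ∈-filterᵇ⁻ _ C∈ in reduced-invariant C∈φ unsat)

  SoundState : Prefix × CNF × List Lit → Set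
  SoundState (Π , φ , U) = Invariant Π φ × (∀ β → All (Holds (γ β)) U)

  UP1-sound : ∀ {Π φ} → Invariant Π φ → SoundState (UP1 Π φ)
  UP1-sound inv = UR-invariant φ′-invariant , units-hold
    where open Round inv

  UPiter-sound : ∀ n {Π φ} → Invariant Π φ → SoundState (UPiter n Π φ)
  UPiter-sound zero    inv = inv , λ _ → []
  UPiter-sound (suc n) {Π} {φ} inv with UP1 Π φ | UP1-sound inv
  ... | (Π′ , φ′ , U) | (inv′ , U-holds) with UPiter n Π′ φ′ | UPiter-sound n inv′
  ...   | (_ , _ , U′) | (inv″ , U′-holds) = inv″ , λ β → ++⁺ (U-holds β) (U′-holds β)

  UP-sound : ∀ {φ} → Valid φ →
             ∃ λ U → UP P φ ≡ units U × (∀ β → All (Holds (γ β)) U)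
  UP-sound {φ} valid with UPiter (UPbound P) P φ | UPiter-sound (UPbound P) initial
    where
    initial : Invariant P φ
    initial = record { univs-⊆ = id ; exs-⊆ = id }
            , All.tabulate (λ C∈ → All.tabulate (λ _ → id) , λ β → All.lookup (valid β) C∈)
  ... | (_ , φ′ , U) | ((_ , clauses) , U-holds)
    rewrite no-empty-clause (All.map (λ c → proj₂ c (λ _ → false)) clauses) = U , refl , U-holds

-- Abstraction of the universal variables in V

override : List Var → Assignment → Assignment → Assignment
override V α β x = if memℕ x V then α x else β x

abstractSkolem : List Var → Assignment → SkolemFamily → SkolemFamily
abstractSkolem V α s z β = if memℕ z V then α z else s z (override V α β)

override-∈ : ∀ V α β x → T (memℕ x V) → override V α β x ≡ α x
override-∈ V α β x = cong (λ b → if b then α x else β x) ∘ to T-≡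

override-self : ∀ V α → override V α α ≗ α
override-self V α x with memℕ x V
... | true  = refl
... | false = refl

module Abstraction (Π : Prefix) (V : List Var) where

  P₀ : Prefix
  P₀ = absPrefix Π V

  inV : Var → Bool
  inV x = memℕ x V

  abstracted : List Var
  abstracted = filterᵇ inV (univs Π)

  exVars-absPrefix : exVars P₀ ≡ exVars Π ++ abstracted
  exVars-absPrefix = begin
    map proj₁ (map restrict (exs Π) ++ map (_, []) abstracted)
      ≡⟨ map-++ proj₁ (map restrict (exs Π)) _ ⟩
    map proj₁ (map restrict (exs Π)) ++ map proj₁ (map (_, []) abstracted)
      ≡⟨ cong₂ _++_ (sym (map-∘ (exs Π))) (sym (map-∘ abstracted)) ⟩
    map proj₁ (exs Π) ++ map id abstracted
      ≡⟨ cong (map proj₁ (exs Π) ++_) (map-id abstracted) ⟩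
    exVars Π ++ abstracted ∎
    where
    open ≡-Reasoning
    restrict : Var × List Var → Var × List Var
    restrict (y , D) = y , filterᵇ (λ x → not (memℕ x V)) D

  isExist-absPrefix-∈ : ∀ {x} → x ∈ univs Π → T (memℕ x V) → T (isExist P₀ x)
  isExist-absPrefix-∈ x∈ x∈V =
    memℕ⁺ (subst (_ ∈_) (sym exVars-absPrefix) (∈-++⁺ʳ (exVars Π) (∈-filterᵇ⁺ inV x∈ x∈V)))

  isExist-absPrefix-∉ : ∀ {x} → memℕ x V ≡ false → isExist P₀ x ≡ isExist Π x
  isExist-absPrefix-∉ {x} x∉V = T-ext
    (λ h → case-∈ (∈-++⁻ (exVars Π) (subst (x ∈_) exVars-absPrefix (memℕ⁻ x (exVars P₀) h))))
    (λ h → memℕ⁺ (subst (x ∈_) (sym exVars-absPrefix) (∈-++⁺ˡ (memℕ⁻ x (exVars Π) h))))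
    where
    case-∈ : x ∈ exVars Π ⊎ x ∈ abstracted → T (isExist Π x)
    case-∈ (inj₁ x∈) = memℕ⁺ x∈
    case-∈ (inj₂ x∈) = contradiction (proj₂ (∈-filterᵇ⁻ inV {xs = univs Π} x∈)) (≡false⇒¬T x∉V)

  module _ {s : SkolemFamily} (s-resp : RespectsDeps Π s) (α : Assignment) where

    abstractSkolem-respects : RespectsDeps P₀ (abstractSkolem V α s)
    abstractSkolem-respects y D y∈ β β′ agree with memℕ y V in y∈V
    ... | true  = refl
    ... | false with ∈-++⁻ (map _ (exs Π)) y∈
    ...   | inj₂ y∈abs with ∈-map⁻ _ y∈abs
    ...     | _ , y∈ , refl =
      contradiction (proj₂ (∈-filterᵇ⁻ inV {xs = univs Π} y∈)) (≡false⇒¬T y∈V)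
    abstractSkolem-respects y _ _ β β′ agree | false | inj₁ y∈restr with ∈-map⁻ _ y∈restr
    ...     | (_ , D) , yD∈ , refl = s-resp y D yD∈ (override V α β) (override V α β′) agree′
      where
      agree′ : ∀ x → x ∈ D → override V α β x ≡ override V α β′ x
      agree′ x x∈D with memℕ x V in x∈V
      ... | true  = refl
      ... | false = agree x (∈-filterᵇ⁺ _ x∈D (from T-not-≡ x∈V))

    module _ (V⊆univs : ∀ {x} → T (memℕ x V) → x ∈ univs Π)
             (univ⇒¬exist : ∀ {x} → x ∈ univs Π → isExist Π x ≡ false) where

      extend-absPrefix : ∀ β → extend P₀ (abstractSkolem V α s) β ≗ extend Π s (override V α β)
      extend-absPrefix β z with memℕ z V in z∈V | isExist P₀ z in z∃₀ | isExist Π z in z∃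
      ... | true  | true  | true  =
        contradiction (trans (sym z∃) (univ⇒¬exist (V⊆univs {z} (from T-≡ z∈V)))) λ ()
      ... | true  | true  | false = refl
      ... | true  | false | _     =
        contradiction (isExist-absPrefix-∈ {z} (V⊆univs (from T-≡ z∈V)) (from T-≡ z∈V))
                      (≡false⇒¬T z∃₀)
      ... | false | _     | _     with trans (sym z∃₀) (trans (isExist-absPrefix-∉ {z} z∈V) z∃)
      extend-absPrefix β z | false | true  | .true  | refl = refl
      extend-absPrefix β z | false | false | .false | refl = refl

-- Probing a variable v

module Probing (Π : Prefix) (φ : CNF) (v : Var) (wf : WellFormed Π φ) (v∈ : v ∈ allVars Π) where

  V : List Var
  V = dep Π v

  open Abstraction Π V

  univ⇒¬exist : ∀ {x} → x ∈ univs Π → isExist Π x ≡ false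
  univ⇒¬exist {x} x∈ = ¬T⇒≡false (Unique-++⇒disjoint (proj₁ wf) x∈ ∘ memℕ⁻ x _)

  dep⊆univs : ∀ {x} → T (memℕ x V) → x ∈ univs Π
  dep⊆univs {x} x∈V with isUniv Π v in univ
  ... | true with memℕ⁻ x (v ∷ []) x∈V
  ...   | here refl = memℕ⁻ v _ (from T-≡ univ)
  dep⊆univs {x} x∈V | false =
    All.lookup (All.lookup (proj₁ (proj₂ wf)) (depsOf-∈ Π (¬univ⇒exist Π univ⇒¬exist v∈ univ)))
               (memℕ⁻ x _ x∈V)

  P₀-univ⇒¬exist : ∀ {x} → x ∈ univs P₀ → isExist P₀ x ≡ false
  P₀-univ⇒¬exist {x} x∈ =
    let x∈univs , x∉V = ∈-filterᵇ⁻ (λ x → not (memℕ x V)) x∈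
    in trans (isExist-absPrefix-∉ {x} (to T-not-≡ x∉V)) (univ⇒¬exist x∈univs)

  propagation-sound : ∀ {s} → IsSkolem Π φ s → ∀ α {ℓ} → var ℓ ≡ v → Holds (extend Π s α) ℓ →
                      ∃ λ U → UP P₀ (addUnit φ ℓ) ≡ units U × All (Holds (extend Π s α)) U
  propagation-sound {s} skolem α {ℓ} refl ℓ-holds =
    let U , UP≡ , U-holds = UP-sound valid
    in U , UP≡ , All.map (λ {κ} → Holds-cong κ (γ≗extend (var κ))) (U-holds α)
    where
    s-resp : RespectsDeps Π s
    s-resp = proj₁ (to (IsSkolem⇔ Π φ) skolem)

    models : ∀ β → All (Sat (extend Π s β)) φ
    models = proj₂ (to (IsSkolem⇔ Π φ) skolem)

    open UnitPropagationSound P₀ (abstractSkolem V α s) (abstractSkolem-respects s-resp α)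
                              P₀-univ⇒¬exist

    γ≗override : ∀ β → γ β ≗ extend Π s (override V α β)
    γ≗override = extend-absPrefix s-resp α dep⊆univs univ⇒¬exist

    γ≗extend : γ α ≗ extend Π s α
    γ≗extend z = trans (γ≗override α z) (extend-cong Π s-resp (override-self V α) z)

    valid : ∀ β → All (Sat (γ β)) (addUnit φ ℓ)
    valid β = ++⁺ (All.map (Sat-cong (sym ∘ γ≗override β)) (models (override V α β)))
                  (here (Holds-cong ℓ (sym ℓ-agrees) ℓ-holds) ∷ [])
      where
      ℓ-agrees : γ β (var ℓ) ≡ extend Π s α (var ℓ)
      ℓ-agrees = trans (γ≗override β (var ℓ))
                       (extend-dep Π univ⇒¬exist s-resp v∈ λ x x∈ → override-∈ V α β x (memℕ⁺ x∈))

  propagated-units-hold : ∀ {s} → IsSkolem Π φ s → ∀ α {ℓ} → var ℓ ≡ v → Holds (extend Π s α) ℓ →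
               All (Holds (extend Π s α)) (unitsOrEmpty (UP P₀ (addUnit φ ℓ)))
  propagated-units-hold skolem α ℓ-v ℓ-holds =
    let _ , UP≡ , U-holds = propagation-sound skolem α ℓ-v ℓ-holds
    in subst (All _ ∘ unitsOrEmpty) (sym UP≡) U-holds

  U1-holds : ∀ {s} → IsSkolem Π φ s → ∀ α → Holds (extend Π s α) (pos v) →
             All (Holds (extend Π s α)) (U1 Π φ v)
  U1-holds skolem α = propagated-units-hold skolem α refl

  U0-holds : ∀ {s} → IsSkolem Π φ s → ∀ α → Holds (extend Π s α) (neg v) →
             All (Holds (extend Π s α)) (U0 Π φ v)
  U0-holds skolem α = propagated-units-hold skolem α refl

  conflict-refutes : ∀ ℓ → var ℓ ≡ v → UP P₀ (addUnit φ ℓ) ≡ conflict →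
                     Equiv Π φ (addUnit φ (negL ℓ))
  conflict-refutes ℓ ℓ-v conflicts = Equiv-++ Π φ λ skolem α → here (Holds-negL⁺ ℓ λ ℓ-holds →
    let _ , UP≡ , _ = propagation-sound skolem α ℓ-v ℓ-holds
    in contradiction (trans (sym conflicts) UP≡) λ ()) ∷ []

  common-units-equiv : Equiv Π φ (φ ++ unitClauses (commonUnits (U0 Π φ v) (U1 Π φ v)))
  common-units-equiv = Equiv-++ Π φ λ skolem α →
    map⁺ (All.tabulate λ κ∈ → here (common-holds skolem α κ∈))
    where
    common-holds : ∀ {s} → IsSkolem Π φ s → ∀ α {κ} → κ ∈ commonUnits (U0 Π φ v) (U1 Π φ v) →
                   Holds (extend Π s α) κ
    common-holds {s} skolem α {κ} κ∈
      with Holds-pos⊎neg (extend Π s α) v | ∈-filterᵇ⁻ (λ κ → memL κ (U0 Π φ v)) κ∈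
    ... | inj₁ v-holds  | κ∈U1 , _    = All.lookup (U1-holds skolem α v-holds) κ∈U1
    ... | inj₂ ¬v-holds | _    , κ∈U0 = All.lookup (U0-holds skolem α ¬v-holds) (memL⁻ κ _ κ∈U0)

  opposite-units-equiv : Equiv Π φ (φ ++ equivClauses v (oppositeUnits (U0 Π φ v) (U1 Π φ v)))
  opposite-units-equiv = Equiv-++ Π φ λ skolem α →
    concat⁺ (map⁺ (All.tabulate (equivalence-holds skolem α)))
    where
    equivalence-holds : ∀ {s} → IsSkolem Π φ s → ∀ α {κ} → κ ∈ oppositeUnits (U0 Π φ v) (U1 Π φ v) →
                        All (Sat (extend Π s α)) ((neg v ∷ κ ∷ []) ∷ (pos v ∷ negL κ ∷ []) ∷ [])
    equivalence-holds {s} skolem α {κ} κ∈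
      with Holds-pos⊎neg (extend Π s α) v | ∈-filterᵇ⁻ (λ κ → memL (negL κ) (U0 Π φ v)) κ∈
    ... | inj₁ v-holds  | κ∈U1 , _ =
      there (here (All.lookup (U1-holds skolem α v-holds) κ∈U1)) ∷ here v-holds ∷ []
    ... | inj₂ ¬v-holds | _ , ¬κ∈U0 =
      here ¬v-holds ∷ there (here (All.lookup (U0-holds skolem α ¬v-holds) (memL⁻ (negL κ) _ ¬κ∈U0)))
        ∷ []

mainTheorem3 : (Π : Prefix) (φ : CNF) (v : ℕ) → WellFormed Π φ → v ∈ allVars Π →
    ((UP (absPrefix Π (dep Π v)) (addUnit φ (pos v)) ≡ conflict → Equiv Π φ (addUnit φ (neg v)))
     × (UP (absPrefix Π (dep Π v)) (addUnit φ (neg v)) ≡ conflict → Equiv Π φ (addUnit φ (pos v))))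
    × Equiv Π φ (φ ++ unitClauses (commonUnits (U0 Π φ v) (U1 Π φ v)))
    × Equiv Π φ (φ ++ equivClauses v (oppositeUnits (U0 Π φ v) (U1 Π φ v)))
mainTheorem3 Π φ v wf v∈ =
    (conflict-refutes (pos v) refl , conflict-refutes (neg v) refl)
  , common-units-equiv
  , opposite-units-equiv
  where open Probing Π φ v wf v∈
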